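{- Among all relaxed unsplit stable assignments $x$ of an instance, the machine-optimal relaxed unsplit stable assignment $x_{\text{mopt}}$ minimizes the total congestion $\sum_{m\in M}\max\bigl(0,\,x(m)-q(m)\bigr)$.
   Context: An instance consists of a finite bipartite graph $G=(J\cup M,E)$ between jobs $J$ and machines $M$; each job $j$ has size $q(j)>0$, each machine $m$ capacity $q(m)>0$; each job strictly ranks its adjacent machines and each machine strictly ranks its adjacent jobs. $M$ contains a dummy machine $m_d$ adjacent to every job, ranked last by every job, with $q(m_d)>\sum_{j\in J}q(j)$. An assignment is $x:E\to\mathbb{R}_{\ge0}$, $x(j)=\sum_m x(jm)$, $x(m)=\sum_j x(jm)$. It is unsplit if $x(jm)\in\{0,q(j)\}$ for all $jm$ and $x(j)\le q(j)$ for all $j$. An unsplit $x$ is a relaxed unsplit assignment if for every machine $m$ with at least one assigned job, $x(m)-q(j_m)<q(m)$, where $j_m$ is the assigned job $m$ likes least. A relaxed unsplit assignment $x$ is stable if for every edge $jm$ with $x(jm)=0$, either $j$ is assigned to a machine it prefers to $m$, or $\sum_{j':m\text{ prefers } j'\text{ to } j}x(j'm)\ge q(m)$. For unsplit $x_1,x_2$, machine $m$ weakly prefers $x_1$ to $x_2$ if either no edge incident to $m$ is positive in exactly one of $x_1,x_2$, or the edge $m$ ranks best among those incident edges positive in exactly one of them is positive in $x_1$. The machine-optimal relaxed unsplit stable assignment $x_{\text{mopt}}$ is the (existing) relaxed unsplit stable assignment that every machine weakly prefers to every relaxed unsplit stable assignment.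
   Formalization: The job sizes $q(j)$ and machine capacities $q(m)$ are rational, and assignments take values in the nonnegative rationals rather than in $\mathbb{R}_{\ge0}$. -}

module Defs where

open import Data.Bool using (Bool; true; false; T; if_then_else_; _∧_)
open import Data.Nat as ℕ using (ℕ; zero; suc)
open import Data.Fin using (Fin)
import Data.Fin as F
open import Data.Rational using (ℚ; 0ℚ; _+_; _-_; _≤_; _<_; _⊔_)
open import Data.Product using (Σ; _×_; ∃; ∃-syntax)
open import Data.Sum using (_⊎_)
open import Relation.Binary.PropositionalEquality using (_≡_; _≢_)
open import Relation.Nullary using (¬_)

sumFin : (n : ℕ) → (Fin n → ℚ) → ℚ
sumFin zero    f = 0ℚ
sumFin (suc n) f = f F.zero + sumFin n (λ i → f (F.suc i))

-- Rankings: a rank number, smaller = more preferred.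
-- Jobs are Fin nJ, machines are Fin nM; the bipartite graph is adj.
record Instance : Set where
  field
    nJ nM : ℕ
    adj   : Fin nJ → Fin nM → Bool
    qJ    : Fin nJ → ℚ
    qM    : Fin nM → ℚ
    qJ-pos : ∀ j → 0ℚ < qJ j
    qM-pos : ∀ m → 0ℚ < qM m
    jrank : Fin nJ → Fin nM → ℕ
    jrank-strict : ∀ j m m' → T (adj j m) → T (adj j m') →
                   jrank j m ≡ jrank j m' → m ≡ m'
    mrank : Fin nM → Fin nJ → ℕ
    mrank-strict : ∀ m j j' → T (adj j m) → T (adj j' m) →
                   mrank m j ≡ mrank m j' → j ≡ j'
    md : Fin nM
    md-adj  : ∀ j → T (adj j md)
    md-last : ∀ j m → T (adj j m) → m ≢ md → jrank j m ℕ.< jrank j md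
    md-cap  : sumFin nJ qJ < qM md

module _ (I : Instance) where
  open Instance I

  -- assignments x : E → ℚ≥0, represented as functions vanishing off E
  Assignment : Set
  Assignment = Fin nJ → Fin nM → ℚ

  IsAssignment : Assignment → Set
  IsAssignment x = (∀ j m → 0ℚ ≤ x j m) × (∀ j m → ¬ T (adj j m) → x j m ≡ 0ℚ)

  loadJ : Assignment → Fin nJ → ℚ
  loadJ x j = sumFin nM (λ m → x j m)

  loadM : Assignment → Fin nM → ℚ
  loadM x m = sumFin nJ (λ j → x j m)

  Unsplit : Assignment → Set
  Unsplit x = IsAssignment x
            × (∀ j m → T (adj j m) → (x j m ≡ 0ℚ) ⊎ (x j m ≡ qJ j))
            × (∀ j → loadJ x j ≤ qJ j)

  LeastLiked : Assignment → Fin nM → Fin nJ → Set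
  LeastLiked x m j = T (adj j m) × 0ℚ < x j m
                   × (∀ j' → T (adj j' m) → 0ℚ < x j' m → mrank m j' ℕ.≤ mrank m j)

  RelaxedUnsplit : Assignment → Set
  RelaxedUnsplit x = Unsplit x
                   × (∀ m j → LeastLiked x m j → loadM x m - qJ j < qM m)

  betterLoad : Assignment → Fin nM → Fin nJ → ℚ
  betterLoad x m j =
    sumFin nJ (λ j' → if adj j' m ∧ (mrank m j' ℕ.<ᵇ mrank m j) then x j' m else 0ℚ)

  Stable : Assignment → Set
  Stable x = RelaxedUnsplit x
           × (∀ j m → T (adj j m) → x j m ≡ 0ℚ →
                (∃[ m' ] (T (adj j m') × 0ℚ < x j m' × jrank j m' ℕ.< jrank j m))
              ⊎ (qM m ≤ betterLoad x m j))

  Differs : Assignment → Assignment → Fin nJ → Fin nM → Set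
  Differs x1 x2 j m = (0ℚ < x1 j m × ¬ (0ℚ < x2 j m))
                    ⊎ (¬ (0ℚ < x1 j m) × 0ℚ < x2 j m)

  WeaklyPrefers : Fin nM → Assignment → Assignment → Set
  WeaklyPrefers m x1 x2 =
      (∀ j → T (adj j m) → ¬ Differs x1 x2 j m)
    ⊎ (∃[ j ] (T (adj j m) × Differs x1 x2 j m
               × (∀ j' → T (adj j' m) → Differs x1 x2 j' m → mrank m j ℕ.≤ mrank m j')
               × 0ℚ < x1 j m))

  MachineOptimal : Assignment → Set
  MachineOptimal x = Stable x × (∀ y → Stable y → ∀ m → WeaklyPrefers m x y)

  congestion : Assignment → ℚ
  congestion x = sumFin nM (λ m → 0ℚ ⊔ (loadM x m - qM m))

{-# OPTIONS --safe #-}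
module Submission where

-- Keep for every job j a rank bound θ j, initially the rank of the dummy machine, and while
-- some machine m that j ranks above θ j would keep j even if every job that m prefers to j and
-- that is within its bound came to m, lower θ j to the rank of m.  This preserves the invariant
-- that every stable assignment puts each job within its bound.  At the fixpoint, sending every
-- job to the machine of rank θ j is itself stable, so it is the job-pessimal stable assignment.
-- Machine optimality forces xmopt to be this assignment: at a machine's best edge where the two
-- differ, stability of the pessimal assignment would make the machine full above a job that
-- xmopt gives it, against the relaxed capacity condition.  Finally, a machine below capacity in
-- the pessimal assignment receives in any stable x only jobs it already has there, and all
-- stable assignments carry the same total load (the dummy machine takes every left-over job),
-- so passing from the pessimal assignment to x can only add congestion.

open import Defs
open import Data.Rational using (_≤_)

import Algebra.Properties.CommutativeMonoid.Sum as CommutativeMonoidSum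
import Algebra.Properties.Monoid.Sum as MonoidSum
open import Data.Bool using (Bool; true; false; T; if_then_else_; _∧_)
open import Data.Bool.Properties using (T?; T-∧)
open import Data.Fin using (Fin; zero; suc)
open import Data.Fin.Properties using (_≟_; any?; suc-injective)
open import Data.List using (List; filter; allFin)
open import Data.List.Extrema.Nat using (argmax; argmin; argmax-all; argmin-all; f[xs]≤f[argmax]; f[argmin]≤f[xs])
open import Data.List.Membership.Propositional using (_∈_)
open import Data.List.Membership.Propositional.Properties using (∈-filter⁺; ∈-allFin)
open import Data.List.Relation.Unary.All as All using (All)
open import Data.List.Relation.Unary.All.Properties using (all-filter)
open import Data.Nat as ℕ using (ℕ)
import Data.Nat.Properties as ℕP
open import Data.Nat.Induction using (<-wellFounded)
open import Data.Product using (_×_; _,_; proj₁; proj₂; ∃; ∃-syntax)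
open import Data.Rational using (ℚ; 0ℚ; _+_; _-_; -_; _<_; _⊔_)
open import Data.Rational.Properties hiding (_≟_)
open import Data.Rational.Solver using (module +-*-Solver)
open import Data.Sum using (_⊎_; inj₁; inj₂)
open import Data.Vec.Functional using (updateAt)
open import Data.Vec.Functional.Properties using (updateAt-updates; updateAt-minimal)
open import Function using (_∘_; const; Equivalence)
open import Induction.WellFounded using (Acc; acc)
open import Relation.Binary.PropositionalEquality
open import Relation.Nullary using (¬_; Dec; yes; no; contradiction)
open import Relation.Nullary.Decidable using (_×-dec_; ¬?; ⌊_⌋; toWitness; fromWitness; decidable-stable)
open import Relation.Unary using (Pred; Decidable)

open +-*-Solver
open Equivalence using (to; from)

module ℚΣ = CommutativeMonoidSum +-0-commutativeMonoid
module ℕΣ = MonoidSum ℕP.+-0-monoid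

+-cancelʳ-≤ : ∀ r {p q} → p + r ≤ q + r → p ≤ q
+-cancelʳ-≤ r {p} {q} p+r≤q+r = begin
  p         ≡⟨ solve 2 (λ p r → p := p :+ r :- r) refl p r ⟩
  p + r - r ≤⟨ +-monoˡ-≤ (- r) p+r≤q+r ⟩
  q + r - r ≡⟨ solve 2 (λ q r → q :+ r :- r := q) refl q r ⟩
  q         ∎
  where open ≤-Reasoning

sumFin≡sum : ∀ n (f : Fin n → ℚ) → sumFin n f ≡ ℚΣ.sum f
sumFin≡sum ℕ.zero    f = refl
sumFin≡sum (ℕ.suc n) f = cong (f zero +_) (sumFin≡sum n (f ∘ suc))

sumFin-cong : ∀ n {f g : Fin n → ℚ} → f ≗ g → sumFin n f ≡ sumFin n g
sumFin-cong n {f} {g} f≗g = begin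
  sumFin n f ≡⟨ sumFin≡sum n f ⟩
  ℚΣ.sum f   ≡⟨ ℚΣ.sum-cong-≗ f≗g ⟩
  ℚΣ.sum g   ≡⟨ sumFin≡sum n g ⟨
  sumFin n g ∎
  where open ≡-Reasoning

sumFin-+ : ∀ n (f g : Fin n → ℚ) → sumFin n (λ i → f i + g i) ≡ sumFin n f + sumFin n g
sumFin-+ n f g = begin
  sumFin n (λ i → f i + g i) ≡⟨ sumFin≡sum n _ ⟩
  ℚΣ.sum (λ i → f i + g i)   ≡⟨ ℚΣ.∑-distrib-+ f g ⟩
  ℚΣ.sum f + ℚΣ.sum g        ≡⟨ cong₂ _+_ (sumFin≡sum n f) (sumFin≡sum n g) ⟨
  sumFin n f + sumFin n g    ∎
  where open ≡-Reasoning

sumFin-comm : ∀ m n (f : Fin m → Fin n → ℚ) →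
              sumFin m (λ i → sumFin n (f i)) ≡ sumFin n (λ j → sumFin m (λ i → f i j))
sumFin-comm m n f = begin
  sumFin m (λ i → sumFin n (f i))          ≡⟨ sumFin≡sum m _ ⟩
  ℚΣ.sum (λ i → sumFin n (f i))            ≡⟨ ℚΣ.sum-cong-≗ (λ i → sumFin≡sum n (f i)) ⟩
  ℚΣ.sum (λ i → ℚΣ.sum (f i))              ≡⟨ ℚΣ.∑-comm f ⟩
  ℚΣ.sum (λ j → ℚΣ.sum (λ i → f i j))      ≡⟨ ℚΣ.sum-cong-≗ (λ j → sumFin≡sum m (λ i → f i j)) ⟨
  ℚΣ.sum (λ j → sumFin m (λ i → f i j))    ≡⟨ sumFin≡sum n _ ⟨
  sumFin n (λ j → sumFin m (λ i → f i j))  ∎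
  where open ≡-Reasoning

sumFin-mono-≤ : ∀ n {f g : Fin n → ℚ} → (∀ i → f i ≤ g i) → sumFin n f ≤ sumFin n g
sumFin-mono-≤ ℕ.zero    f≤g = ≤-refl
sumFin-mono-≤ (ℕ.suc n) f≤g = +-mono-≤ (f≤g zero) (sumFin-mono-≤ n (f≤g ∘ suc))

sumFin-nonneg : ∀ n {f : Fin n → ℚ} → (∀ i → 0ℚ ≤ f i) → 0ℚ ≤ sumFin n f
sumFin-nonneg ℕ.zero    f≥0 = ≤-refl
sumFin-nonneg (ℕ.suc n) f≥0 = +-mono-≤ (f≥0 zero) (sumFin-nonneg n (f≥0 ∘ suc))

p≤p+q : ∀ {p q} → 0ℚ ≤ q → p ≤ p + q
p≤p+q {p} {q} q≥0 = begin
  p      ≡⟨ +-identityʳ p ⟨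
  p + 0ℚ ≤⟨ +-monoʳ-≤ p q≥0 ⟩
  p + q  ∎
  where open ≤-Reasoning

p≤q+p : ∀ {p q} → 0ℚ ≤ q → p ≤ q + p
p≤q+p {p} {q} q≥0 = subst (p ≤_) (+-comm p q) (p≤p+q q≥0)

sumFin-point : ∀ n {f : Fin n → ℚ} → (∀ i → 0ℚ ≤ f i) → ∀ j → f j ≤ sumFin n f
sumFin-point (ℕ.suc n) f≥0 zero    = p≤p+q (sumFin-nonneg n (f≥0 ∘ suc))
sumFin-point (ℕ.suc n) f≥0 (suc j) = ≤-trans (sumFin-point n (f≥0 ∘ suc) j) (p≤q+p (f≥0 zero))

sumFin-pair : ∀ n {f : Fin n → ℚ} → (∀ i → 0ℚ ≤ f i) → ∀ {i j} → i ≢ j → f i + f j ≤ sumFin n f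
sumFin-pair (ℕ.suc n) f≥0 {zero} {zero} 0≢0 = contradiction refl 0≢0
sumFin-pair (ℕ.suc n) {f} f≥0 {zero} {suc j} _ = +-monoʳ-≤ (f zero) (sumFin-point n (f≥0 ∘ suc) j)
sumFin-pair (ℕ.suc n) {f} f≥0 {suc i} {zero} _ = begin
  f (suc i) + f zero          ≡⟨ +-comm (f (suc i)) (f zero) ⟩
  f zero + f (suc i)          ≤⟨ +-monoʳ-≤ (f zero) (sumFin-point n (f≥0 ∘ suc) i) ⟩
  f zero + sumFin n (f ∘ suc) ∎
  where open ≤-Reasoning
sumFin-pair (ℕ.suc n) f≥0 {suc i} {suc j} i≢j =
  ≤-trans (sumFin-pair n (f≥0 ∘ suc) (i≢j ∘ cong suc)) (p≤q+p (f≥0 zero))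

sumFin-mono-except : ∀ n {f g : Fin n → ℚ} j → (∀ i → i ≢ j → f i ≤ g i) →
                     sumFin n f + g j ≤ sumFin n g + f j
sumFin-mono-except (ℕ.suc n) {f} {g} zero f≤g = begin
  f zero + sumFin n (f ∘ suc) + g zero ≡⟨ solve 3 (λ a F b → a :+ F :+ b := b :+ F :+ a) refl
                                            (f zero) (sumFin n (f ∘ suc)) (g zero) ⟩
  g zero + sumFin n (f ∘ suc) + f zero ≤⟨ +-monoˡ-≤ (f zero) (+-monoʳ-≤ (g zero)
                                            (sumFin-mono-≤ n (λ i → f≤g (suc i) λ ()))) ⟩
  g zero + sumFin n (g ∘ suc) + f zero ∎
  where open ≤-Reasoning
sumFin-mono-except (ℕ.suc n) {f} {g} (suc j) f≤g = begin
  f zero + sumFin n (f ∘ suc) + g (suc j)   ≡⟨ +-assoc (f zero) _ _ ⟩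
  f zero + (sumFin n (f ∘ suc) + g (suc j)) ≤⟨ +-mono-≤ (f≤g zero λ ())
                                                (sumFin-mono-except n j λ i i≢j → f≤g (suc i) (i≢j ∘ suc-injective)) ⟩
  g zero + (sumFin n (g ∘ suc) + f (suc j)) ≡⟨ +-assoc (g zero) _ _ ⟨
  g zero + sumFin n (g ∘ suc) + f (suc j)   ∎
  where open ≤-Reasoning

sumFin-zero : ∀ n {f : Fin n → ℚ} → (∀ i → f i ≡ 0ℚ) → sumFin n f ≡ 0ℚ
sumFin-zero ℕ.zero    f≡0 = refl
sumFin-zero (ℕ.suc n) f≡0 = cong₂ _+_ (f≡0 zero) (sumFin-zero n (f≡0 ∘ suc))

sumFin-single : ∀ n {f : Fin n → ℚ} j → (∀ i → i ≢ j → f i ≡ 0ℚ) → sumFin n f ≡ f j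
sumFin-single (ℕ.suc n) {f} zero f≡0 = begin
  f zero + sumFin n (f ∘ suc) ≡⟨ cong (f zero +_) (sumFin-zero n (λ i → f≡0 (suc i) λ ())) ⟩
  f zero + 0ℚ                 ≡⟨ +-identityʳ (f zero) ⟩
  f zero                      ∎
  where open ≡-Reasoning
sumFin-single (ℕ.suc n) {f} (suc j) f≡0 = begin
  f zero + sumFin n (f ∘ suc) ≡⟨ cong (_+ sumFin n (f ∘ suc)) (f≡0 zero λ ()) ⟩
  0ℚ + sumFin n (f ∘ suc)     ≡⟨ +-identityˡ _ ⟩
  sumFin n (f ∘ suc)          ≡⟨ sumFin-single n j (λ i i≢j → f≡0 (suc i) (i≢j ∘ suc-injective)) ⟩
  f (suc j)                   ∎
  where open ≡-Reasoning

excess : ℚ → ℚ → ℚ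
excess c a = 0ℚ ⊔ (a - c)

p≤q⇒0≤q-p : ∀ {p q} → p ≤ q → 0ℚ ≤ q - p
p≤q⇒0≤q-p {p} {q} p≤q = subst (_≤ q - p) (+-inverseʳ p) (+-monoˡ-≤ (- p) p≤q)

p≤q⇒p-q≤0 : ∀ {p q} → p ≤ q → p - q ≤ 0ℚ
p≤q⇒p-q≤0 {p} {q} p≤q = subst (p - q ≤_) (+-inverseʳ q) (+-monoˡ-≤ (- q) p≤q)

excess-+-≤ : ∀ {c a b} → (a < c → b ≤ a) → excess c a + b ≤ excess c b + a
excess-+-≤ {c} {a} {b} underfull⇒b≤a with c ≤? a
... | yes c≤a = begin
  excess c a + b       ≡⟨ cong (_+ b) (p≤q⇒p⊔q≡q (p≤q⇒0≤q-p c≤a)) ⟩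
  a - c + b            ≡⟨ solve 3 (λ a b c → a :- c :+ b := b :- c :+ a) refl a b c ⟩
  b - c + a            ≤⟨ +-monoˡ-≤ a (p≤q⊔p 0ℚ (b - c)) ⟩
  excess c b + a       ∎
  where open ≤-Reasoning
... | no c≰a = begin
  excess c a + b       ≡⟨ cong (_+ b) (p≥q⇒p⊔q≡p (p≤q⇒p-q≤0 (<⇒≤ a<c))) ⟩
  0ℚ + b               ≡⟨ +-identityˡ b ⟩
  b                    ≤⟨ underfull⇒b≤a a<c ⟩
  a                    ≤⟨ p≤q+p (p≤p⊔q 0ℚ (b - c)) ⟩
  excess c b + a       ∎
  where
  open ≤-Reasoning
  a<c : a < c
  a<c = ≰⇒> c≰a

sumFin-excess-≤ : ∀ n (c a b : Fin n → ℚ) → sumFin n a ≡ sumFin n b →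
                  (∀ i → a i < c i → b i ≤ a i) →
                  sumFin n (λ i → excess (c i) (a i)) ≤ sumFin n (λ i → excess (c i) (b i))
sumFin-excess-≤ n c a b Σa≡Σb underfull⇒b≤a = +-cancelʳ-≤ (sumFin n b) (begin
  sumFin n excessᵃ + sumFin n b     ≡⟨ sumFin-+ n excessᵃ b ⟨
  sumFin n (λ i → excessᵃ i + b i)  ≤⟨ sumFin-mono-≤ n (λ i → excess-+-≤ (underfull⇒b≤a i)) ⟩
  sumFin n (λ i → excessᵇ i + a i)  ≡⟨ sumFin-+ n excessᵇ a ⟩
  sumFin n excessᵇ + sumFin n a     ≡⟨ cong (sumFin n excessᵇ +_) Σa≡Σb ⟩
  sumFin n excessᵇ + sumFin n b     ∎)
  where
  open ≤-Reasoning
  excessᵃ excessᵇ : Fin n → ℚ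
  excessᵃ i = excess (c i) (a i)
  excessᵇ i = excess (c i) (b i)

if-true : ∀ {A : Set} b {p q : A} → T b → (if b then p else q) ≡ p
if-true true _ = refl

if-false : ∀ {A : Set} b {p q : A} → ¬ T b → (if b then p else q) ≡ q
if-false true  ¬t = contradiction _ ¬t
if-false false _  = refl

if-monoʳ-≤ : ∀ b {p q} → (T b → p ≤ q) → (if b then p else 0ℚ) ≤ (if b then q else 0ℚ)
if-monoʳ-≤ true  p≤q = p≤q _
if-monoʳ-≤ false _   = ≤-refl

if-monoˡ-≤ : ∀ b c {p} → (T b → T c) → 0ℚ ≤ p → (if b then p else 0ℚ) ≤ (if c then p else 0ℚ)
if-monoˡ-≤ true  true  _   _   = ≤-refl
if-monoˡ-≤ true  false b⇒c _   = contradiction (b⇒c _) λ ()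
if-monoˡ-≤ false true  _   p≥0 = p≥0
if-monoˡ-≤ false false _   _   = ≤-refl

module _ {n p} {P : Pred (Fin n) p} (P? : Decidable P) (key : Fin n → ℕ) where
  private
    candidates : List (Fin n)
    candidates = filter P? (allFin n)

    ∈-candidates : ∀ {i} → P i → i ∈ candidates
    ∈-candidates = ∈-filter⁺ P? (∈-allFin _)

  argmax-∃ : ∀ {a} → P a → ∃[ b ] (P b × ∀ i → P i → key i ℕ.≤ key b)
  argmax-∃ {a} Pa = argmax key a candidates
                  , argmax-all key Pa (all-filter P? (allFin n))
                  , λ i Pi → All.lookup (f[xs]≤f[argmax] a candidates) (∈-candidates Pi)

  argmin-∃ : ∀ {a} → P a → ∃[ b ] (P b × ∀ i → P i → key b ℕ.≤ key i)
  argmin-∃ {a} Pa = argmin key a candidates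
                  , argmin-all key Pa (all-filter P? (allFin n))
                  , λ i Pi → All.lookup (f[argmin]≤f[xs] a candidates) (∈-candidates Pi)

ℕΣ-mono-≤ : ∀ {n} {f g : Fin n → ℕ} → (∀ i → f i ℕ.≤ g i) → ℕΣ.sum f ℕ.≤ ℕΣ.sum g
ℕΣ-mono-≤ {ℕ.zero}  _   = ℕ.z≤n
ℕΣ-mono-≤ {ℕ.suc n} f≤g = ℕP.+-mono-≤ (f≤g zero) (ℕΣ-mono-≤ (f≤g ∘ suc))

ℕΣ-mono-< : ∀ {n} {f g : Fin n → ℕ} → (∀ i → f i ℕ.≤ g i) → ∀ j → f j ℕ.< g j → ℕΣ.sum f ℕ.< ℕΣ.sum g
ℕΣ-mono-< {ℕ.suc n} f≤g zero    f0<g0 = ℕP.+-mono-<-≤ f0<g0 (ℕΣ-mono-≤ (f≤g ∘ suc))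
ℕΣ-mono-< {ℕ.suc n} f≤g (suc j) fj<gj = ℕP.+-mono-≤-< (f≤g zero) (ℕΣ-mono-< (f≤g ∘ suc) j fj<gj)

module _ (I : Instance) where
  open Instance I

  qJ-nonneg : ∀ j → 0ℚ ≤ qJ j
  qJ-nonneg j = <⇒≤ (qJ-pos j)

  prefersᵇ : Fin nM → Fin nJ → Fin nJ → Bool
  prefersᵇ m i j = adj i m ∧ (mrank m i ℕ.<ᵇ mrank m j)

  prefersᵇ⇒ : ∀ {m i j} → T (prefersᵇ m i j) → T (adj i m) × mrank m i ℕ.< mrank m j
  prefersᵇ⇒ {m} {i} {j} t with to T-∧ t
  ... | adjacent , ranked = adjacent , ℕP.<ᵇ⇒< (mrank m i) (mrank m j) ranked

  ⇒prefersᵇ : ∀ {m i j} → T (adj i m) → mrank m i ℕ.< mrank m j → T (prefersᵇ m i j)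
  ⇒prefersᵇ adjacent ranked = from T-∧ (adjacent , ℕP.<⇒<ᵇ ranked)

  betterLoad-mono : ∀ {x y : Assignment I} m j →
                    (∀ i → T (adj i m) → mrank m i ℕ.< mrank m j → x i m ≤ y i m) →
                    betterLoad I x m j ≤ betterLoad I y m j
  betterLoad-mono m j x≤y = sumFin-mono-≤ nJ λ i →
    if-monoʳ-≤ (prefersᵇ m i j) λ t → x≤y i (proj₁ (prefersᵇ⇒ t)) (proj₂ (prefersᵇ⇒ t))

  betterLoad≤totalSize : ∀ {x : Assignment I} {m j} → (∀ i → x i m ≤ qJ i) →
                         betterLoad I x m j ≤ sumFin nJ qJ
  betterLoad≤totalSize {m = m} {j} x≤q = sumFin-mono-≤ nJ λ i →
    ≤-trans (if-monoʳ-≤ (prefersᵇ m i j) λ _ → x≤q i) (if-monoˡ-≤ (prefersᵇ m i j) true _ (qJ-nonneg i))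

  congestion-cong : ∀ {x y : Assignment I} → (∀ j m → x j m ≡ y j m) → congestion I x ≡ congestion I y
  congestion-cong x≡y = sumFin-cong nM λ m →
    cong (excess (qM m)) (sumFin-cong nJ λ j → x≡y j m)

  module _ {x : Assignment I} (u : Unsplit I x) where
    nonneg : ∀ j m → 0ℚ ≤ x j m
    nonneg = proj₁ (proj₁ u)

    off-edge⇒0 : ∀ {j m} → ¬ T (adj j m) → x j m ≡ 0ℚ
    off-edge⇒0 = proj₂ (proj₁ u) _ _

    positive⇒adj : ∀ {j m} → 0ℚ < x j m → T (adj j m)
    positive⇒adj {j} {m} p with T? (adj j m)
    ... | yes adjacent = adjacent
    ... | no ¬adjacent = contradiction p (<-irrefl (sym (off-edge⇒0 ¬adjacent)))

    positive⇒size : ∀ {j m} → 0ℚ < x j m → x j m ≡ qJ j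
    positive⇒size {j} {m} p with proj₁ (proj₂ u) j m (positive⇒adj p)
    ... | inj₁ x≡0    = contradiction p (<-irrefl (sym x≡0))
    ... | inj₂ x≡size = x≡size

    ¬positive⇒0 : ∀ {j m} → ¬ 0ℚ < x j m → x j m ≡ 0ℚ
    ¬positive⇒0 {j} {m} ¬p = ≤-antisym (≮⇒≥ ¬p) (nonneg j m)

    ≤size : ∀ j m → x j m ≤ qJ j
    ≤size j m with 0ℚ <? x j m
    ... | yes p  = ≤-reflexive (positive⇒size p)
    ... | no  ¬p = ≤-trans (≤-reflexive (¬positive⇒0 ¬p)) (qJ-nonneg j)

    positive-unique : ∀ {j m m′} → 0ℚ < x j m → 0ℚ < x j m′ → m ≡ m′
    positive-unique {j} {m} {m′} p p′ with m ≟ m′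
    ... | yes m≡m′ = m≡m′
    ... | no  m≢m′ = contradiction (<-≤-trans once<twice twice≤once) (<-irrefl refl)
      where
      once<twice : qJ j < qJ j + qJ j
      once<twice = subst (_< qJ j + qJ j) (+-identityʳ (qJ j)) (+-monoʳ-< (qJ j) (qJ-pos j))
      twice≤once : qJ j + qJ j ≤ qJ j
      twice≤once = begin
        qJ j + qJ j     ≡⟨ cong₂ _+_ (positive⇒size p) (positive⇒size p′) ⟨
        x j m + x j m′  ≤⟨ sumFin-pair nM (nonneg j) m≢m′ ⟩
        loadJ I x j     ≤⟨ proj₂ (proj₂ u) j ⟩
        qJ j            ∎
        where open ≤-Reasoning

    betterLoad≤loadM : ∀ {m j} → betterLoad I x m j ≤ loadM I x m
    betterLoad≤loadM {m} {j} = sumFin-mono-≤ nJ λ i →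
      if-monoˡ-≤ (prefersᵇ m i j) true _ (nonneg i m)

    betterLoad-monoʳ : ∀ {m i j} → mrank m i ℕ.≤ mrank m j → betterLoad I x m i ≤ betterLoad I x m j
    betterLoad-monoʳ {m} {i} {j} i≤j = sumFin-mono-≤ nJ λ k →
      if-monoˡ-≤ (prefersᵇ m k i) (prefersᵇ m k j) (widen k) (nonneg k m)
      where
      widen : ∀ k → T (prefersᵇ m k i) → T (prefersᵇ m k j)
      widen k t = ⇒prefersᵇ (proj₁ (prefersᵇ⇒ t)) (ℕP.<-≤-trans (proj₂ (prefersᵇ⇒ t)) i≤j)

    loadM≡betterLoad+least : ∀ {m ℓ} → LeastLiked I x m ℓ → loadM I x m ≡ betterLoad I x m ℓ + x ℓ m
    loadM≡betterLoad+least {m} {ℓ} (ℓ-adjacent , _ , ℓ-least) = ≤-antisym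
      (begin
        loadM I x m                          ≡⟨ +-identityʳ _ ⟨
        loadM I x m + 0ℚ                     ≡⟨ cong (loadM I x m +_) masked-ℓ ⟨
        loadM I x m + masked ℓ               ≤⟨ sumFin-mono-except nJ ℓ x≤masked ⟩
        betterLoad I x m ℓ + x ℓ m           ∎)
      (begin
        betterLoad I x m ℓ + x ℓ m           ≤⟨ sumFin-mono-except nJ ℓ (λ i _ → masked≤x i) ⟩
        loadM I x m + masked ℓ               ≡⟨ cong (loadM I x m +_) masked-ℓ ⟩
        loadM I x m + 0ℚ                     ≡⟨ +-identityʳ _ ⟩
        loadM I x m                          ∎)
      where
      open ≤-Reasoning
      masked : Fin nJ → ℚ
      masked i = if prefersᵇ m i ℓ then x i m else 0ℚ

      masked-ℓ : masked ℓ ≡ 0ℚ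
      masked-ℓ = if-false (prefersᵇ m ℓ ℓ) λ t → ℕP.<-irrefl refl (proj₂ (prefersᵇ⇒ t))

      masked≤x : ∀ i → masked i ≤ x i m
      masked≤x i = if-monoˡ-≤ (prefersᵇ m i ℓ) true _ (nonneg i m)

      x≤masked : ∀ i → i ≢ ℓ → x i m ≤ masked i
      x≤masked i i≢ℓ with 0ℚ <? x i m
      ... | no ¬p = ≤-trans (≤-reflexive (¬positive⇒0 ¬p))
                            (if-monoˡ-≤ false (prefersᵇ m i ℓ) (λ ()) (nonneg i m))
      ... | yes p = ≤-reflexive (sym (if-true (prefersᵇ m i ℓ) (⇒prefersᵇ adjacent ranked)))
        where
        adjacent : T (adj i m)
        adjacent = positive⇒adj p
        ranked : mrank m i ℕ.< mrank m ℓ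
        ranked = ℕP.≤∧≢⇒< (ℓ-least i adjacent p) (i≢ℓ ∘ mrank-strict m i ℓ adjacent ℓ-adjacent)

    leastLiked-∃ : ∀ {d m} → 0ℚ < x d m → ∃ (LeastLiked I x m)
    leastLiked-∃ {d} {m} p
      with argmax-∃ (λ i → T? (adj i m) ×-dec (0ℚ <? x i m)) (mrank m) (positive⇒adj p , p)
    ... | ℓ , (adjacent , positive) , ℓ-last = ℓ , adjacent , positive , λ i aᵢ pᵢ → ℓ-last i (aᵢ , pᵢ)

    loadM-size≡betterLoad : ∀ {m ℓ} → LeastLiked I x m ℓ → loadM I x m - qJ ℓ ≡ betterLoad I x m ℓ
    loadM-size≡betterLoad {m} {ℓ} least@(_ , p , _) = begin
      loadM I x m - qJ ℓ                ≡⟨ cong (_- qJ ℓ) (loadM≡betterLoad+least least) ⟩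
      betterLoad I x m ℓ + x ℓ m - qJ ℓ ≡⟨ cong (λ s → betterLoad I x m ℓ + s - qJ ℓ) (positive⇒size p) ⟩
      betterLoad I x m ℓ + qJ ℓ - qJ ℓ  ≡⟨ solve 2 (λ b q → b :+ q :- q := b) refl _ (qJ ℓ) ⟩
      betterLoad I x m ℓ                ∎
      where open ≡-Reasoning

  unsplit : ∀ {x : Assignment I} → Stable I x → Unsplit I x
  unsplit = proj₁ ∘ proj₁

  -- At m's least liked job ℓ the relaxed capacity condition reads betterLoad I x m ℓ < qM m.
  relaxed⇒betterLoad< : ∀ {x : Assignment I} → RelaxedUnsplit I x →
                        ∀ {d m} → 0ℚ < x d m → betterLoad I x m d < qM m
  relaxed⇒betterLoad< {x} (u , relaxed) {d} {m} p with leastLiked-∃ u p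
  ... | ℓ , least@(_ , _ , ℓ-last) = begin-strict
    betterLoad I x m d ≤⟨ betterLoad-monoʳ u (ℓ-last d (positive⇒adj u p) p) ⟩
    betterLoad I x m ℓ ≡⟨ loadM-size≡betterLoad u least ⟨
    loadM I x m - qJ ℓ <⟨ relaxed m ℓ least ⟩
    qM m               ∎
    where open ≤-Reasoning

  ¬differs⇒≡ : ∀ {x y : Assignment I} → Unsplit I x → Unsplit I y →
               ∀ {j m} → ¬ Differs I x y j m → x j m ≡ y j m
  ¬differs⇒≡ {x} {y} ux uy {j} {m} ¬differs with 0ℚ <? x j m | 0ℚ <? y j m
  ... | yes px | yes py = trans (positive⇒size ux px) (sym (positive⇒size uy py))
  ... | no ¬px | no ¬py = trans (¬positive⇒0 ux ¬px) (sym (¬positive⇒0 uy ¬py))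
  ... | yes px | no ¬py = contradiction (inj₁ (px , ¬py)) ¬differs
  ... | no ¬px | yes py = contradiction (inj₂ (¬px , py)) ¬differs

  differs⇒¬positive : ∀ {x y : Assignment I} {j m} → Differs I x y j m → 0ℚ < x j m → ¬ 0ℚ < y j m
  differs⇒¬positive (inj₁ (_ , ¬py)) _  = ¬py
  differs⇒¬positive (inj₂ (¬px , _)) px = contradiction px ¬px

  module _ {x : Assignment I} (st : Stable I x) where
    loadJ-stable : ∀ j → loadJ I x j ≡ qJ j
    loadJ-stable j with any? (λ m → 0ℚ <? x j m)
    ... | yes (m , p) = ≤-antisym (proj₂ (proj₂ (unsplit st)) j)
      (subst (_≤ loadJ I x j) (positive⇒size (unsplit st) p) (sumFin-point nM (nonneg (unsplit st) j) m))
    ... | no unassigned with proj₂ st j md (md-adj j) (¬positive⇒0 (unsplit st) λ p → unassigned (md , p))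
    ...   | inj₁ (m , _ , p , _) = contradiction (m , p) unassigned
    ...   | inj₂ md-full = contradiction
      (≤-<-trans md-full (≤-<-trans (betterLoad≤totalSize {x} (λ i → ≤size (unsplit st) i md)) md-cap))
      (<-irrefl refl)

    totalLoad-stable : sumFin nM (loadM I x) ≡ sumFin nJ qJ
    totalLoad-stable = trans (sym (sumFin-comm nJ nM x)) (sumFin-cong nJ loadJ-stable)

  assignTo : (Fin nJ → Fin nM) → Assignment I
  assignTo c j m = if ⌊ m ≟ c j ⌋ then qJ j else 0ℚ

  module _ (c : Fin nJ → Fin nM) where
    assignTo-≡ : ∀ {j m} → m ≡ c j → assignTo c j m ≡ qJ j
    assignTo-≡ {j} {m} m≡cj = if-true (⌊ m ≟ c j ⌋) (fromWitness {a? = m ≟ c j} m≡cj)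

    assignTo-≢ : ∀ {j m} → m ≢ c j → assignTo c j m ≡ 0ℚ
    assignTo-≢ {j} {m} m≢cj = if-false (⌊ m ≟ c j ⌋) (m≢cj ∘ toWitness {a? = m ≟ c j})

    assignTo-positive⇒≡ : ∀ {j m} → 0ℚ < assignTo c j m → m ≡ c j
    assignTo-positive⇒≡ {j} {m} p with m ≟ c j
    ... | yes m≡cj = m≡cj
    ... | no  _    = contradiction p (<-irrefl refl)

    assignTo-≡0⇒≢ : ∀ {j m} → assignTo c j m ≡ 0ℚ → m ≢ c j
    assignTo-≡0⇒≢ {j} unassigned m≡cj = <-irrefl (trans (sym unassigned) (assignTo-≡ m≡cj)) (qJ-pos j)

    assignTo-positive : ∀ j → 0ℚ < assignTo c j (c j)
    assignTo-positive j = subst (0ℚ <_) (sym (assignTo-≡ refl)) (qJ-pos j)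

    assignTo-nonneg : ∀ j m → 0ℚ ≤ assignTo c j m
    assignTo-nonneg j m = if-monoˡ-≤ false (⌊ m ≟ c j ⌋) (λ ()) (qJ-nonneg j)

    assignTo-unsplit : (∀ j → T (adj j (c j))) → Unsplit I (assignTo c)
    assignTo-unsplit adjacent = (assignTo-nonneg , off-edge) , sized , λ j → ≤-reflexive (loaded j)
      where
      off-edge : ∀ j m → ¬ T (adj j m) → assignTo c j m ≡ 0ℚ
      off-edge j m ¬adjacent = assignTo-≢ λ m≡cj → ¬adjacent (subst (T ∘ adj j) (sym m≡cj) (adjacent j))

      sized : ∀ j m → T (adj j m) → (assignTo c j m ≡ 0ℚ) ⊎ (assignTo c j m ≡ qJ j)
      sized j m _ with m ≟ c j
      ... | yes _ = inj₂ refl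
      ... | no  _ = inj₁ refl

      loaded : ∀ j → loadJ I (assignTo c) j ≡ qJ j
      loaded j = trans (sumFin-single nM (c j) λ m → assignTo-≢) (assignTo-≡ refl)

  Bound : Set
  Bound = Fin nJ → ℕ

  -- Not a genuine assignment: every job sits on each machine it ranks within its bound.
  potential : Bound → Assignment I
  potential θ i m = if jrank i m ℕ.≤ᵇ θ i then qJ i else 0ℚ

  potential-nonneg : ∀ θ i m → 0ℚ ≤ potential θ i m
  potential-nonneg θ i m = if-monoˡ-≤ false (jrank i m ℕ.≤ᵇ θ i) (λ ()) (qJ-nonneg i)

  potential≤size : ∀ θ i m → potential θ i m ≤ qJ i
  potential≤size θ i m = if-monoˡ-≤ (jrank i m ℕ.≤ᵇ θ i) true _ (qJ-nonneg i)

  potential-mono : ∀ {θ θ′} → (∀ i → θ i ℕ.≤ θ′ i) → ∀ i m → potential θ i m ≤ potential θ′ i m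
  potential-mono {θ} {θ′} θ≤θ′ i m = if-monoˡ-≤ (jrank i m ℕ.≤ᵇ θ i) (jrank i m ℕ.≤ᵇ θ′ i)
    (λ t → ℕP.≤⇒≤ᵇ (ℕP.≤-trans (ℕP.≤ᵇ⇒≤ (jrank i m) (θ i) t) (θ≤θ′ i))) (qJ-nonneg i)

  Admits : Bound → Fin nM → Fin nJ → Set
  Admits θ m j = T (adj j m) × jrank j m ℕ.≤ θ j × betterLoad I (potential θ) m j < qM m

  admits? : ∀ θ m j → Dec (Admits θ m j)
  admits? θ m j = T? (adj j m) ×-dec (jrank j m ℕ.≤? θ j) ×-dec (betterLoad I (potential θ) m j <? qM m)

  admits-anti : ∀ {θ θ′ m j} → (∀ i → θ′ i ℕ.≤ θ i) → Admits θ m j → jrank j m ℕ.≤ θ′ j → Admits θ′ m j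
  admits-anti {θ} {θ′} {m} {j} θ′≤θ (adjacent , _ , fits) ranked =
    adjacent , ranked ,
    ≤-<-trans (betterLoad-mono {potential θ′} {potential θ} m j λ i _ _ → potential-mono θ′≤θ i m) fits

  Sound : Bound → Set
  Sound θ = ∀ x → Stable I x → ∀ j m → 0ℚ < x j m → jrank j m ℕ.≤ θ j

  Attained : Bound → Set
  Attained θ = ∀ j → ∃[ m ] (Admits θ m j × jrank j m ≡ θ j)

  Fixed : Bound → Set
  Fixed θ = ∀ j m → Admits θ m j → θ j ℕ.≤ jrank j m

  stable≤potential : ∀ {θ x} → Sound θ → Stable I x → ∀ i m → x i m ≤ potential θ i m
  stable≤potential {θ} {x} sound st i m with 0ℚ <? x i m
  ... | yes p  = ≤-reflexive (trans (positive⇒size (unsplit st) p)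
                   (sym (if-true (jrank i m ℕ.≤ᵇ θ i) (ℕP.≤⇒≤ᵇ (sound x st i m p)))))
  ... | no  ¬p = subst (_≤ potential θ i m) (sym (¬positive⇒0 (unsplit st) ¬p)) (potential-nonneg θ i m)

  stable-rank≤admitting : ∀ {θ m j x m′} → Sound θ → Admits θ m j → Stable I x →
                          0ℚ < x j m′ → jrank j m′ ℕ.≤ jrank j m
  stable-rank≤admitting {θ} {m} {j} {x} {m′} sound (adjacent , _ , fits) st p′ = ℕP.≮⇒≥ m-better
    where
    u : Unsplit I x
    u = unsplit st
    m-better : ¬ jrank j m ℕ.< jrank j m′
    m-better m<m′ with 0ℚ <? x j m
    ... | yes p = ℕP.<-irrefl (cong (jrank j) (positive-unique u p p′)) m<m′
    ... | no ¬p with proj₂ st j m adjacent (¬positive⇒0 u ¬p)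
    ...   | inj₁ (m″ , _ , p″ , m″<m) =
            ℕP.<-asym m<m′ (subst (λ k → jrank j k ℕ.< jrank j m) (positive-unique u p″ p′) m″<m)
    ...   | inj₂ m-full = <-irrefl refl (begin-strict
            qM m                             ≤⟨ m-full ⟩
            betterLoad I x m j               ≤⟨ betterLoad-mono {x} {potential θ} m j
                                                  (λ i _ _ → stable≤potential sound st i m) ⟩
            betterLoad I (potential θ) m j   <⟨ fits ⟩
            qM m                             ∎)
      where open ≤-Reasoning

  lower : Bound → Fin nJ → ℕ → Bound
  lower θ j r = updateAt θ j (const r)

  lower-≤ : ∀ {θ j r} → r ℕ.≤ θ j → ∀ i → lower θ j r i ℕ.≤ θ i
  lower-≤ {θ} {j} r≤θj i with i ≟ j
  ... | yes refl = subst (ℕ._≤ θ i) (sym (updateAt-updates i θ)) r≤θj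
  ... | no  i≢j  = ℕP.≤-reflexive (updateAt-minimal i j θ i≢j)

  lower-sound : ∀ {θ m j} → Sound θ → Admits θ m j → Sound (lower θ j (jrank j m))
  lower-sound {θ} {m} {j} sound admits x st i m′ p with i ≟ j
  ... | yes refl = subst (jrank i m′ ℕ.≤_) (sym (updateAt-updates i θ))
                         (stable-rank≤admitting sound admits st p)
  ... | no  i≢j  = subst (jrank i m′ ℕ.≤_) (sym (updateAt-minimal i j θ i≢j)) (sound x st i m′ p)

  lower-attained : ∀ {θ m j} → Attained θ → Admits θ m j → jrank j m ℕ.< θ j →
                   Attained (lower θ j (jrank j m))
  lower-attained {θ} {m} {j} attained admits m<θj i with i ≟ j
  ... | yes refl = m , admits-anti (lower-≤ (ℕP.<⇒≤ m<θj)) admits (ℕP.≤-reflexive rank≡) , rank≡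
    where
    rank≡ : jrank i m ≡ lower θ i (jrank i m) i
    rank≡ = sym (updateAt-updates i θ)
  ... | no  i≢j with attained i
  ...   | c , c-admits , c-rank =
          c , admits-anti (lower-≤ (ℕP.<⇒≤ m<θj)) c-admits (ℕP.≤-reflexive rank≡) , rank≡
    where
    rank≡ : jrank i c ≡ lower θ j (jrank j m) i
    rank≡ = trans c-rank (sym (updateAt-minimal i j θ i≢j))

  fixpoint-from : ∀ θ → Acc ℕ._<_ (ℕΣ.sum θ) → Sound θ → Attained θ →
                  ∃[ θ* ] (Sound θ* × Attained θ* × Fixed θ*)
  fixpoint-from θ (acc smaller) sound attained
    with any? (λ j → any? (λ m → admits? θ m j ×-dec (jrank j m ℕ.<? θ j)))
  ... | no  none = θ , sound , attained , λ j m admits → ℕP.≮⇒≥ λ m<θj → none (j , m , admits , m<θj)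
  ... | yes (j , m , admits , m<θj) =
        fixpoint-from (lower θ j (jrank j m)) (smaller lowered-sum)
                      (lower-sound sound admits) (lower-attained attained admits m<θj)
    where
    lowered-sum : ℕΣ.sum (lower θ j (jrank j m)) ℕ.< ℕΣ.sum θ
    lowered-sum = ℕΣ-mono-< (lower-≤ (ℕP.<⇒≤ m<θj)) j
                    (subst (ℕ._< θ j) (sym (updateAt-updates j θ)) m<θj)

  dummyRank : Bound
  dummyRank j = jrank j md

  dummyRank-sound : Sound dummyRank
  dummyRank-sound x st j m p with m ≟ md
  ... | yes refl = ℕP.≤-refl
  ... | no  m≢md = ℕP.<⇒≤ (md-last j m (positive⇒adj (unsplit st) p) m≢md)

  dummyRank-attained : Attained dummyRank
  dummyRank-attained j = md , (md-adj j , ℕP.≤-refl , fits) , refl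
    where
    fits : betterLoad I (potential dummyRank) md j < qM md
    fits = ≤-<-trans (betterLoad≤totalSize {potential dummyRank} (λ i → potential≤size dummyRank i md))
                     md-cap

  fixpoint : ∃[ θ ] (Sound θ × Attained θ × Fixed θ)
  fixpoint = fixpoint-from dummyRank (<-wellFounded _) dummyRank-sound dummyRank-attained

  module Pessimal {θ : Bound} (sound : Sound θ) (attained : Attained θ) (fixed : Fixed θ) where
    choice : Fin nJ → Fin nM
    choice j = proj₁ (attained j)

    choice-admits : ∀ j → Admits θ (choice j) j
    choice-admits j = proj₁ (proj₂ (attained j))

    choice-rank : ∀ j → jrank j (choice j) ≡ θ j
    choice-rank j = proj₂ (proj₂ (attained j))

    admits⇒choice : ∀ {m j} → Admits θ m j → m ≡ choice j
    admits⇒choice {m} {j} admits@(adjacent , ranked , _) =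
      jrank-strict j m (choice j) adjacent (proj₁ (choice-admits j))
        (trans (ℕP.≤-antisym ranked (fixed j m admits)) (sym (choice-rank j)))

    pessimal : Assignment I
    pessimal = assignTo choice

    pessimal-unsplit : Unsplit I pessimal
    pessimal-unsplit = assignTo-unsplit choice (proj₁ ∘ choice-admits)

    pessimal≤potential : ∀ i m → pessimal i m ≤ potential θ i m
    pessimal≤potential i m with m ≟ choice i
    ... | yes m≡ci = ≤-reflexive (sym (if-true (jrank i m ℕ.≤ᵇ θ i)
                       (ℕP.≤⇒≤ᵇ (ℕP.≤-reflexive (trans (cong (jrank i) m≡ci) (choice-rank i))))))
    ... | no  _    = potential-nonneg θ i m

    pessimal-relaxed : RelaxedUnsplit I pessimal
    pessimal-relaxed = pessimal-unsplit , relaxed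
      where
      relaxed : ∀ m ℓ → LeastLiked I pessimal m ℓ → loadM I pessimal m - qJ ℓ < qM m
      relaxed m ℓ least@(_ , p , _) = begin-strict
        loadM I pessimal m - qJ ℓ       ≡⟨ loadM-size≡betterLoad pessimal-unsplit least ⟩
        betterLoad I pessimal m ℓ       ≤⟨ betterLoad-mono {pessimal} {potential θ} m ℓ
                                             (λ i _ _ → pessimal≤potential i m) ⟩
        betterLoad I (potential θ) m ℓ  <⟨ proj₂ (proj₂ m-admits-ℓ) ⟩
        qM m                            ∎
        where
        open ≤-Reasoning
        m-admits-ℓ : Admits θ m ℓ
        m-admits-ℓ = subst (λ k → Admits θ k ℓ) (sym (assignTo-positive⇒≡ choice p)) (choice-admits ℓ)

    Rejected : Fin nM → Fin nJ → Set
    Rejected m j = T (adj j m) × jrank j m ℕ.≤ θ j × m ≢ choice j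

    rejected? : ∀ m j → Dec (Rejected m j)
    rejected? m j = T? (adj j m) ×-dec (jrank j m ℕ.≤? θ j) ×-dec ¬? (m ≟ choice j)

    rejected⇒potential-full : ∀ {m j} → Rejected m j → qM m ≤ betterLoad I (potential θ) m j
    rejected⇒potential-full (adjacent , ranked , m≢cj) =
      ≮⇒≥ λ fits → m≢cj (admits⇒choice (adjacent , ranked , fits))

    -- Pass to the rejected job i that m likes best: every job m prefers to i and that is within
    -- its bound is actually on m, so the potential load above i is carried by pessimal.
    rejected⇒full : ∀ {m j} → Rejected m j → qM m ≤ betterLoad I pessimal m j
    rejected⇒full {m} {j} j-rejected with argmin-∃ (rejected? m) (mrank m) j-rejected
    ... | i , i-rejected , i-first = begin
      qM m                            ≤⟨ rejected⇒potential-full i-rejected ⟩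
      betterLoad I (potential θ) m i  ≤⟨ betterLoad-mono {potential θ} {pessimal} m i potential≤pessimal ⟩
      betterLoad I pessimal m i       ≤⟨ betterLoad-monoʳ pessimal-unsplit (i-first j j-rejected) ⟩
      betterLoad I pessimal m j       ∎
      where
      open ≤-Reasoning
      potential≤pessimal : ∀ k → T (adj k m) → mrank m k ℕ.< mrank m i → potential θ k m ≤ pessimal k m
      potential≤pessimal k aₖ k<i with jrank k m ℕ.≤? θ k
      ... | no  k-out = subst (_≤ pessimal k m) (sym (if-false (jrank k m ℕ.≤ᵇ θ k) (k-out ∘ ℕP.≤ᵇ⇒≤ _ _)))
                          (assignTo-nonneg choice k m)
      ... | yes rₖ with m ≟ choice k
      ...   | yes _    = potential≤size θ k m
      ...   | no  m≢cₖ = contradiction (i-first k (aₖ , rₖ , m≢cₖ)) (ℕP.<⇒≱ k<i)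

    pessimal-stable : Stable I pessimal
    pessimal-stable = pessimal-relaxed , unblocked
      where
      unblocked : ∀ j m → T (adj j m) → pessimal j m ≡ 0ℚ →
                  (∃[ m′ ] (T (adj j m′) × 0ℚ < pessimal j m′ × jrank j m′ ℕ.< jrank j m))
                  ⊎ (qM m ≤ betterLoad I pessimal m j)
      unblocked j m adjacent unassigned with jrank j (choice j) ℕ.<? jrank j m
      ... | yes prefers = inj₁ (choice j , proj₁ (choice-admits j) , assignTo-positive choice j , prefers)
      ... | no ¬prefers = inj₂ (rejected⇒full (adjacent , ranked , assignTo-≡0⇒≢ choice unassigned))
        where
        ranked : jrank j m ℕ.≤ θ j
        ranked = ℕP.≤-trans (ℕP.≮⇒≥ ¬prefers) (ℕP.≤-reflexive (choice-rank j))

    displaced⇒full : ∀ {x i m} → Stable I x → 0ℚ < x i m → m ≢ choice i →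
                     qM m ≤ betterLoad I pessimal m i
    displaced⇒full {x} {i} {m} st p m≢ci
      with proj₂ pessimal-stable i m (positive⇒adj (unsplit st) p) (assignTo-≢ choice m≢ci)
    ... | inj₂ m-full = m-full
    ... | inj₁ (m′ , _ , p′ , m′<m) = contradiction (sound x st i m p) (ℕP.<⇒≱ θi<m)
      where
      θi<m : θ i ℕ.< jrank i m
      θi<m = subst (ℕ._< jrank i m)
               (trans (cong (jrank i) (assignTo-positive⇒≡ choice p′)) (choice-rank i)) m′<m

    underfull⇒dominated : ∀ {x m} → Stable I x → loadM I pessimal m < qM m → ∀ i → x i m ≤ pessimal i m
    underfull⇒dominated {x} {m} st underfull i with 0ℚ <? x i m
    ... | no  ¬p = ≤-trans (≤-reflexive (¬positive⇒0 (unsplit st) ¬p)) (assignTo-nonneg choice i m)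
    ... | yes p  = ≤-trans (≤size (unsplit st) i m) (≤-reflexive (sym (assignTo-≡ choice m≡ci)))
      where
      m≡ci : m ≡ choice i
      m≡ci = decidable-stable (m ≟ choice i) λ m≢ci → <-irrefl refl
               (≤-<-trans (displaced⇒full st p m≢ci) (≤-<-trans (betterLoad≤loadM pessimal-unsplit) underfull))

    pessimal-congestion-≤ : ∀ {x} → Stable I x → congestion I pessimal ≤ congestion I x
    pessimal-congestion-≤ {x} st = sumFin-excess-≤ nM qM (loadM I pessimal) (loadM I x)
      (trans (totalLoad-stable pessimal-stable) (sym (totalLoad-stable st)))
      (λ m underfull → sumFin-mono-≤ nJ (underfull⇒dominated st underfull))

    machineOptimal≡pessimal : ∀ {z} → MachineOptimal I z → ∀ j m → z j m ≡ pessimal j m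
    machineOptimal≡pessimal {z} (stz , optimal) j m = agreement (optimal pessimal pessimal-stable m)
      where
      agreement : WeaklyPrefers I m z pessimal → z j m ≡ pessimal j m
      agreement (inj₁ agree) with T? (adj j m)
      ... | yes adjacent = ¬differs⇒≡ (unsplit stz) pessimal-unsplit (agree j adjacent)
      ... | no ¬adjacent = trans (off-edge⇒0 (unsplit stz) ¬adjacent)
                                 (sym (off-edge⇒0 pessimal-unsplit ¬adjacent))
      agreement (inj₂ (d , _ , differs , d-first , pz)) = contradiction (begin-strict
        qM m                       ≤⟨ displaced⇒full stz pz m≢cd ⟩
        betterLoad I pessimal m d  ≤⟨ betterLoad-mono {pessimal} {z} m d agree-above ⟩
        betterLoad I z m d         <⟨ relaxed⇒betterLoad< (proj₁ stz) pz ⟩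
        qM m                       ∎) (<-irrefl refl)
        where
        open ≤-Reasoning
        m≢cd : m ≢ choice d
        m≢cd m≡cd = differs⇒¬positive {z} {pessimal} differs pz
                      (subst (λ k → 0ℚ < pessimal d k) (sym m≡cd) (assignTo-positive choice d))
        agree-above : ∀ i → T (adj i m) → mrank m i ℕ.< mrank m d → pessimal i m ≤ z i m
        agree-above i aᵢ i<d = ≤-reflexive (sym (¬differs⇒≡ (unsplit stz) pessimal-unsplit
                                 λ differsᵢ → ℕP.<⇒≱ i<d (d-first i aᵢ differsᵢ)))

theorem4 : (I : Instance) (xmopt : Assignment I) → MachineOptimal I xmopt →
           (x : Assignment I) → Stable I x →
           congestion I xmopt ≤ congestion I x
theorem4 I xmopt optimal x stable with fixpoint I
... | θ , sound , attained , fixed = begin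
  congestion I xmopt     ≡⟨ congestion-cong I (machineOptimal≡pessimal optimal) ⟩
  congestion I pessimal  ≤⟨ pessimal-congestion-≤ stable ⟩
  congestion I x         ∎
  where
  open Pessimal I sound attained fixed
  open ≤-Reasoning
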